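{- Let $m\ge1$ and $\mathbf a=(a_0,\dots,a_m)$ with $a_0\neq0$. For all integers $p\ge0$ and $n\ge0$, $$\sum_{k=0}^{p}\frac{1}{a_0^k}\binom{k}{n}_{\mathbf a}=\sum_{i=\lceil n/m\rceil}^{n}\frac{1}{a_0^i}\,\alpha_{n,i}\binom{p+1}{i+1},$$ where $\alpha_{n,i}=[t^{\,n-i}]\big(a_1+a_2t+\dots+a_mt^{m-1}\big)^i$.
   Context: For $\mathbf a=(a_0,\dots,a_m)$ let $p_{\mathbf a}(t)=\sum_{i=0}^m a_i t^i$. The polynomial coefficients are defined, for integers $k\ge 0$ and $n$, by $\binom{k}{n}_{\mathbf a}=[t^n]\,p_{\mathbf a}(t)^k$ if $0\le n\le mk$, and $0$ if $n<0$ or $n>mk$, where $[t^n]F(t)$ is the coefficient of $t^n$ in $F$ (and $[t^j]F=0$ for $j<0$). $\binom{p+1}{i+1}$ is the ordinary binomial coefficient. -}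

module Defs where

open import Level using (_⊔_)
open import Data.Nat as ℕ using (ℕ; zero; suc; _∸_; _/_)
open import Data.List using (List; []; _∷_; map)
open import Relation.Nullary using (¬_)
open import Algebra.Bundles using (CommutativeRing)
import Algebra.Definitions.RawMonoid as RawMonoidDefs

record Field c ℓ : Set (Level.suc (c ⊔ ℓ)) where
  field
    commutativeRing : CommutativeRing c ℓ
  open CommutativeRing commutativeRing public
  field
    inv        : (x : Carrier) → ¬ (x ≈ 0#) → Carrier
    inv-right  : (x : Carrier) (nz : ¬ (x ≈ 0#)) → x * inv x nz ≈ 1#
    1≉0        : ¬ (1# ≈ 0#)

-- ⌈ n / m ⌉ for m ≥ 1 (value at m = 0 irrelevant)
ceilDiv : ℕ → ℕ → ℕ
ceilDiv n zero    = 0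
ceilDiv n (suc k) = (n ℕ.+ k) / suc k

module Poly {c ℓ} (R : CommutativeRing c ℓ) where
  open CommutativeRing R

  -- polynomials as coefficient lists, constant term first
  addP : List Carrier → List Carrier → List Carrier
  addP []       q        = q
  addP (x ∷ p)  []       = x ∷ p
  addP (x ∷ p)  (y ∷ q)  = (x + y) ∷ addP p q

  mulP : List Carrier → List Carrier → List Carrier
  mulP []      q = []
  mulP (x ∷ p) q = addP (map (x *_) q) (0# ∷ mulP p q)

  powP : List Carrier → ℕ → List Carrier
  powP p zero    = 1# ∷ []
  powP p (suc k) = mulP p (powP p k)

  coeff : List Carrier → ℕ → Carrier
  coeff []      n       = 0#
  coeff (x ∷ p) zero    = x
  coeff (x ∷ p) (suc n) = coeff p n

  _^ᴿ_ : Carrier → ℕ → Carrier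
  x ^ᴿ zero  = 1#
  x ^ᴿ suc k = x * (x ^ᴿ k)

  open RawMonoidDefs +-rawMonoid public using () renaming (_×_ to _×ᴿ_)

  sumCount : ℕ → ℕ → (ℕ → Carrier) → Carrier
  sumCount lo zero      f = 0#
  sumCount lo (suc len) f = f lo + sumCount (suc lo) len f

  -- Σ_{i = lo}^{hi} f i  (empty if lo > hi)
  sumFromTo : ℕ → ℕ → (ℕ → Carrier) → Carrier
  sumFromTo lo hi f = sumCount lo (suc hi ∸ lo) f

  -- the polynomial coefficient binom(k, n)_a = [t^n] p_a(t)^k, a = (a_0,...,a_m)
  polyCoeff : List Carrier → ℕ → ℕ → Carrier
  polyCoeff a k n = coeff (powP a k) n

-- Write p_a(t) = a₀ + t·q(t) with q = (a₁, …, a_m) and let u = a₀⁻¹.  Then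
-- uᵏ p_a(t)ᵏ = (1 + T)ᵏ 1, where T is the linear operator "multiply by u·t·q(t)"
-- on coefficient sequences, and Tⁱ 1 = uⁱ tⁱ q(t)ⁱ.  The binomial theorem for
-- T therefore gives
--     uᵏ [tⁿ] p_aᵏ = Σ_{i ≤ k} C(k,i) uⁱ [tⁿ⁻ⁱ] qⁱ .
-- Summing over k ≤ p with the hockey-stick identity Σ_{k ≤ p} C(k,i) = C(p+1,i+1)
-- yields Σ_{i ≤ p} C(p+1,i+1) uⁱ [tⁿ⁻ⁱ] qⁱ.  Finally the range of i is cut down to
-- ⌈n/m⌉ ≤ i ≤ n: terms with i > p or i > n vanish (binomial coefficient, factor tⁱ),
-- and terms with i < ⌈n/m⌉ vanish because deg qⁱ ≤ i(m-1) < n - i.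
module Submission where

open import Defs
open import Data.Nat using (ℕ; zero; suc; _≤_; _<_; _≤′_; _∸_; z≤n; s≤s; ≤′-reflexive; ≤′-step)
import Data.Nat as ℕ
import Data.Nat.Properties as ℕP
open import Data.Nat.DivMod using (m<n*o⇒m/o<n; m/n*n≤m)
open import Data.Nat.GeneralisedArithmetic using (fold)
open import Data.Nat.Combinatorics using (_C_; k>n⇒nCk≡0; nCk+nC[k+1]≡[n+1]C[k+1])
open import Data.List using (List; []; _∷_; map; length)
open import Data.Vec using (Vec; head; tail; toList) renaming (_∷_ to _∷ᵥ_)
open import Data.Vec.Properties using (length-toList)
open import Data.Sum using (inj₁; inj₂)
open import Algebra.Bundles using (CommutativeRing)
open import Relation.Nullary using (¬_)
import Relation.Binary.PropositionalEquality as P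

-- ⌈n/m⌉ ≤ n (for m ≥ 1), so the window ⌈n/m⌉ ≤ i ≤ n is a genuine interval.
ceilDiv-≤ : ∀ n k → ceilDiv n (suc k) ≤ n
ceilDiv-≤ n k = ℕP.≤-pred (m<n*o⇒m/o<n {n ℕ.+ k} {suc n} {suc k} n+k<[1+n]*[1+k])
  where
  n+k<[1+n]*[1+k] : n ℕ.+ k < suc n ℕ.* suc k
  n+k<[1+n]*[1+k] = s≤s (ℕP.≤-trans (ℕP.≤-reflexive (ℕP.+-comm n k))
                                   (ℕP.+-monoʳ-≤ k (ℕP.m≤m*n n (suc k))))

-- Below ⌈n/(k+1)⌉ the degree bound i·k of qⁱ is smaller than the index n - i.
<ceilDiv⇒*<∸ : ∀ n k i → i < ceilDiv n (suc k) → i ℕ.* k < n ∸ i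
<ceilDiv⇒*<∸ n k i i<⌈n/m⌉ =
  P.subst (_< n ∸ i) (ℕP.m+n∸m≡n i (i ℕ.* k))
    (ℕP.∸-monoˡ-< (P.subst (_< n) (ℕP.*-suc i k) i*m<n) (ℕP.m≤m+n i (i ℕ.* k)))
  where
  open ℕP.≤-Reasoning
  i*m<n : i ℕ.* suc k < n
  i*m<n = ℕP.+-cancelˡ-< k (i ℕ.* suc k) n (begin-strict
    k ℕ.+ i ℕ.* suc k          <⟨ ℕP.n<1+n _ ⟩
    suc i ℕ.* suc k            ≤⟨ ℕP.*-monoˡ-≤ (suc k) i<⌈n/m⌉ ⟩
    ceilDiv n (suc k) ℕ.* suc k ≤⟨ m/n*n≤m (n ℕ.+ k) (suc k) ⟩
    n ℕ.+ k                    ≡⟨ ℕP.+-comm n k ⟩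
    k ℕ.+ n                    ∎)

module Development {c ℓ} (R : CommutativeRing c ℓ) where
  open CommutativeRing R
  open Poly R
  open import Relation.Binary.Reasoning.Setoid setoid
  open import Algebra.Properties.Monoid.Mult +-monoid using (×-homo-+)
  import Algebra.Properties.CommutativeSemigroup as CommutativeSemigroupProperties
  module +-CS = CommutativeSemigroupProperties +-commutativeSemigroup
  module *-CS = CommutativeSemigroupProperties *-commutativeSemigroup

  Seq : Set c
  Seq = ℕ → Carrier

  infix 4 _≋_
  _≋_ : Seq → Seq → Set ℓ
  f ≋ g = ∀ n → f n ≈ g n

  ∑ : ℕ → Seq → Carrier
  ∑ zero    f = 0#
  ∑ (suc n) f = f 0 + ∑ n (λ j → f (suc j))

  ∑-cong< : ∀ n {f g : Seq} → (∀ j → j < n → f j ≈ g j) → ∑ n f ≈ ∑ n g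
  ∑-cong< zero    eq = refl
  ∑-cong< (suc n) eq = +-cong (eq 0 (s≤s z≤n)) (∑-cong< n (λ j j<n → eq (suc j) (s≤s j<n)))

  ∑-cong : ∀ n {f g : Seq} → f ≋ g → ∑ n f ≈ ∑ n g
  ∑-cong n eq = ∑-cong< n (λ j _ → eq j)

  ∑-zero< : ∀ n {f : Seq} → (∀ j → j < n → f j ≈ 0#) → ∑ n f ≈ 0#
  ∑-zero< zero    vanish = refl
  ∑-zero< (suc n) vanish = trans (+-cong (vanish 0 (s≤s z≤n)) (∑-zero< n (λ j j<n → vanish (suc j) (s≤s j<n))))
                                 (+-identityʳ 0#)

  ∑-+ : ∀ n (f g : Seq) → ∑ n (λ j → f j + g j) ≈ ∑ n f + ∑ n g
  ∑-+ zero    f g = sym (+-identityʳ 0#)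
  ∑-+ (suc n) f g = trans (+-cong refl (∑-+ n _ _)) (+-CS.interchange _ _ _ _)

  ∑-split : ∀ a b (f : Seq) → ∑ (a ℕ.+ b) f ≈ ∑ a f + ∑ b (λ j → f (a ℕ.+ j))
  ∑-split zero    b f = sym (+-identityˡ _)
  ∑-split (suc a) b f = trans (+-cong refl (∑-split a b _)) (sym (+-assoc _ _ _))

  ∑-last : ∀ n (f : Seq) → ∑ (suc n) f ≈ ∑ n f + f n
  ∑-last zero    f = trans (+-identityʳ _) (sym (+-identityˡ _))
  ∑-last (suc n) f = trans (+-cong refl (∑-last n _)) (sym (+-assoc _ _ _))

  sumCount-∑ : ∀ lo len (f : Seq) → sumCount lo len f ≈ ∑ len (λ j → f (lo ℕ.+ j))
  sumCount-∑ lo zero      f = refl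
  sumCount-∑ lo (suc len) f =
    +-cong (reflexive (P.cong f (P.sym (ℕP.+-identityʳ lo))))
           (trans (sumCount-∑ (suc lo) len f)
                  (∑-cong len (λ j → reflexive (P.cong f (P.sym (ℕP.+-suc lo j))))))

  ∑-stable : ∀ {L N} (f : Seq) → (∀ i → L ≤ i → f i ≈ 0#) → L ≤′ N → ∑ N f ≈ ∑ L f
  ∑-stable f vanish (≤′-reflexive P.refl) = refl
  ∑-stable f vanish (≤′-step {N} L≤′N) = begin
    ∑ (suc N) f  ≈⟨ ∑-last N f ⟩
    ∑ N f + f N  ≈⟨ +-cong (∑-stable f vanish L≤′N) (vanish N (ℕP.≤′⇒≤ L≤′N)) ⟩
    _ + 0#       ≈⟨ +-identityʳ _ ⟩
    _            ∎

  ∑-truncation : ∀ L L′ (f : Seq) → (∀ i → L ≤ i → f i ≈ 0#) → (∀ i → L′ ≤ i → f i ≈ 0#) →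
                 ∑ L f ≈ ∑ L′ f
  ∑-truncation L L′ f vanish vanish′ with ℕP.≤-total L L′
  ... | inj₁ L≤L′ = sym (∑-stable f vanish (ℕP.≤⇒≤′ L≤L′))
  ... | inj₂ L′≤L = ∑-stable f vanish′ (ℕP.≤⇒≤′ L′≤L)

  ∑-window : ∀ lo len {f g : Seq} → (∀ i → i < lo → f i ≈ 0#) →
             (∀ j → j < len → f (lo ℕ.+ j) ≈ g (lo ℕ.+ j)) → ∑ (lo ℕ.+ len) f ≈ sumCount lo len g
  ∑-window lo len {f} {g} below agree = begin
    ∑ (lo ℕ.+ len) f                         ≈⟨ ∑-split lo len f ⟩
    ∑ lo f + ∑ len (λ j → f (lo ℕ.+ j))      ≈⟨ +-cong (∑-zero< lo below) (∑-cong< len agree) ⟩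
    0# + ∑ len (λ j → g (lo ℕ.+ j))          ≈⟨ +-identityˡ _ ⟩
    ∑ len (λ j → g (lo ℕ.+ j))               ≈⟨ sumCount-∑ lo len g ⟨
    sumCount lo len g                        ∎

  conv : Seq → Seq → Seq
  conv f g zero    = f 0 * g 0
  conv f g (suc n) = f 0 * g (suc n) + conv (λ j → f (suc j)) g n

  conv-congʳ : ∀ (f : Seq) {g g′ : Seq} → g ≋ g′ → conv f g ≋ conv f g′
  conv-congʳ f eq zero    = *-cong refl (eq 0)
  conv-congʳ f eq (suc n) = +-cong (*-cong refl (eq (suc n))) (conv-congʳ _ eq n)

  conv-zeroˡ : ∀ {f : Seq} (g : Seq) → f ≋ (λ _ → 0#) → conv f g ≋ (λ _ → 0#)
  conv-zeroˡ g f≋0 zero    = trans (*-cong (f≋0 0) refl) (zeroˡ _)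
  conv-zeroˡ g f≋0 (suc n) =
    trans (+-cong (trans (*-cong (f≋0 0) refl) (zeroˡ _)) (conv-zeroˡ g (λ j → f≋0 (suc j)) n))
          (+-identityʳ 0#)

  conv-+ʳ : ∀ (f g h : Seq) → conv f (λ j → g j + h j) ≋ (λ n → conv f g n + conv f h n)
  conv-+ʳ f g h zero    = distribˡ _ _ _
  conv-+ʳ f g h (suc n) = trans (+-cong (distribˡ _ _ _) (conv-+ʳ _ g h n)) (+-CS.interchange _ _ _ _)

  conv-*ʳ : ∀ (f g : Seq) x → conv f (λ j → x * g j) ≋ (λ n → x * conv f g n)
  conv-*ʳ f g x zero    = *-CS.x∙yz≈y∙xz _ _ _
  conv-*ʳ f g x (suc n) = trans (+-cong (*-CS.x∙yz≈y∙xz _ _ _) (conv-*ʳ _ g x n)) (sym (distribˡ _ _ _))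

  -- Multiplication by t.
  sh : Seq → Seq
  sh g zero    = 0#
  sh g (suc n) = g n

  sh-cong : ∀ {g g′ : Seq} → g ≋ g′ → sh g ≋ sh g′
  sh-cong eq zero    = refl
  sh-cong eq (suc n) = eq n

  sh-+ : ∀ (g h : Seq) → sh (λ j → g j + h j) ≋ (λ n → sh g n + sh h n)
  sh-+ g h zero    = sym (+-identityʳ 0#)
  sh-+ g h (suc n) = refl

  sh-* : ∀ x (g : Seq) → (λ n → x * sh g n) ≋ sh (λ j → x * g j)
  sh-* x g zero    = zeroʳ x
  sh-* x g (suc n) = refl

  conv-sh : ∀ (f g : Seq) → conv f (sh g) ≋ sh (conv f g)
  conv-sh f g zero    = zeroʳ _
  conv-sh f g (suc n) = trans (+-cong refl (conv-sh _ g n)) (absorb n)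
    where
    absorb : ∀ n → f 0 * g n + sh (conv (λ j → f (suc j)) g) n ≈ conv f g n
    absorb zero    = +-identityʳ _
    absorb (suc n) = refl

  shiftBy : ℕ → Seq → Seq
  shiftBy zero    g = g
  shiftBy (suc i) g = sh (shiftBy i g)

  shiftBy-cong : ∀ i {g g′ : Seq} → g ≋ g′ → shiftBy i g ≋ shiftBy i g′
  shiftBy-cong zero    eq = eq
  shiftBy-cong (suc i) eq = sh-cong (shiftBy-cong i eq)

  conv-shiftBy : ∀ (f g : Seq) i → conv f (shiftBy i g) ≋ shiftBy i (conv f g)
  conv-shiftBy f g zero    n = refl
  conv-shiftBy f g (suc i) n = trans (conv-sh f (shiftBy i g) n) (sh-cong (conv-shiftBy f g i) n)

  shiftBy-below : ∀ i (g : Seq) n → n < i → shiftBy i g n ≈ 0#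
  shiftBy-below (suc i) g zero    _         = refl
  shiftBy-below (suc i) g (suc n) (s≤s n<i) = shiftBy-below i g n n<i

  shiftBy-above : ∀ i (g : Seq) n → i ≤ n → shiftBy i g n ≈ g (n ∸ i)
  shiftBy-above zero    g n       _         = refl
  shiftBy-above (suc i) g (suc n) (s≤s i≤n) = shiftBy-above i g n i≤n

  coeff-addP : ∀ p q n → coeff (addP p q) n ≈ coeff p n + coeff q n
  coeff-addP []      q       n       = sym (+-identityˡ _)
  coeff-addP (x ∷ p) []      n       = sym (+-identityʳ _)
  coeff-addP (x ∷ p) (y ∷ q) zero    = refl
  coeff-addP (x ∷ p) (y ∷ q) (suc n) = coeff-addP p q n

  coeff-map : ∀ x q n → coeff (map (x *_) q) n ≈ x * coeff q n
  coeff-map x []      n       = sym (zeroʳ x)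
  coeff-map x (y ∷ q) zero    = refl
  coeff-map x (y ∷ q) (suc n) = coeff-map x q n

  coeff-mulP : ∀ p q → coeff (mulP p q) ≋ conv (coeff p) (coeff q)
  coeff-mulP []      q n       = sym (conv-zeroˡ (coeff q) (λ _ → refl) n)
  coeff-mulP (x ∷ p) q zero    =
    trans (coeff-addP (map (x *_) q) _ 0) (trans (+-cong (coeff-map x q 0) refl) (+-identityʳ _))
  coeff-mulP (x ∷ p) q (suc n) =
    trans (coeff-addP (map (x *_) q) _ (suc n)) (+-cong (coeff-map x q (suc n)) (coeff-mulP p q n))

  conv-cons : ∀ x xs (g : Seq) → conv (coeff (x ∷ xs)) g ≋ (λ n → x * g n + sh (conv (coeff xs) g) n)
  conv-cons x xs g zero    = sym (+-identityʳ _)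
  conv-cons x xs g (suc n) = refl

  VanishesAbove : ℕ → Seq → Set ℓ
  VanishesAbove d f = ∀ j → d < j → f j ≈ 0#

  conv-vanishes : ∀ d₁ d₂ {f g : Seq} → VanishesAbove d₁ f → VanishesAbove d₂ g →
                  VanishesAbove (d₁ ℕ.+ d₂) (conv f g)
  conv-vanishes d₁ d₂ vf vg zero ()
  conv-vanishes d₁ d₂ {f} {g} vf vg (suc n) d<n =
    trans (+-cong (trans (*-cong refl (vg (suc n) (ℕP.≤-<-trans (ℕP.m≤n+m d₂ d₁) d<n))) (zeroʳ _))
                  (tail-vanishes d₁ vf d<n))
          (+-identityʳ 0#)
    where
    tail-vanishes : ∀ d₁ {f : Seq} → VanishesAbove d₁ f → d₁ ℕ.+ d₂ < suc n →
                    conv (λ j → f (suc j)) g n ≈ 0#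
    tail-vanishes zero    vf _         = conv-zeroˡ g (λ j → vf (suc j) (s≤s z≤n)) n
    tail-vanishes (suc e) vf (s≤s e<n) = conv-vanishes e d₂ (λ j e<j → vf (suc j) (s≤s e<j)) vg n e<n

  powP-vanishes : ∀ k qs → VanishesAbove k (coeff qs) → ∀ i → VanishesAbove (i ℕ.* k) (coeff (powP qs i))
  powP-vanishes k qs vq zero    (suc j) _   = refl
  powP-vanishes k qs vq (suc i) j       k<j =
    trans (coeff-mulP qs (powP qs i) j) (conv-vanishes k (i ℕ.* k) vq (powP-vanishes k qs vq i) j k<j)

  coeff-beyond-length : ∀ xs j → length xs ≤ j → coeff xs j ≈ 0#
  coeff-beyond-length []       j       _         = refl
  coeff-beyond-length (x ∷ xs) (suc j) (s≤s ≤j) = coeff-beyond-length xs j ≤j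

  vector-vanishes : ∀ {k} (w : Vec Carrier (suc k)) → VanishesAbove k (coeff (toList w))
  vector-vanishes w j k<j = coeff-beyond-length (toList w) j (P.subst (_≤ j) (P.sym (length-toList w)) k<j)

  cC : ℕ → ℕ → Carrier
  cC k i = (k C i) ×ᴿ 1#

  cC-pascal : ∀ k i → cC (suc k) (suc i) ≈ cC k i + cC k (suc i)
  cC-pascal k i = trans (reflexive (P.cong (_×ᴿ 1#) (P.sym (nCk+nC[k+1]≡[n+1]C[k+1] k i))))
                        (×-homo-+ 1# (k C i) (k C suc i))

  cC-vanishes : ∀ {k i} → k < i → cC k i ≈ 0#
  cC-vanishes k<i = reflexive (P.cong (_×ᴿ 1#) (k>n⇒nCk≡0 k<i))

  pascal-term : ∀ k i x → cC k i * x + cC k (suc i) * x ≈ cC (suc k) (suc i) * x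
  pascal-term k i x = trans (sym (distribʳ x _ _)) (*-cong (sym (cC-pascal k i)) refl)

  binomial-tail : ∀ k (h : Seq) → ∑ (suc k) (λ i → cC k (suc i) * h i) ≈ ∑ k (λ i → cC k (suc i) * h i)
  binomial-tail k h = ∑-stable {L = k} (λ i → cC k (suc i) * h i) (λ i k≤i → trans (*-cong (cC-vanishes (s≤s k≤i)) refl) (zeroˡ _))
                                 (≤′-step (≤′-reflexive P.refl))

  pascal-sum : ∀ k (g : Seq) → ∑ (suc (suc k)) (λ i → cC (suc k) i * g i)
               ≈ ∑ (suc k) (λ i → cC k i * g i) + ∑ (suc k) (λ i → cC k i * g (suc i))
  pascal-sum k g = begin
    g₀ + ∑ (suc k) (λ i → cC (suc k) (suc i) * g (suc i))
      ≈⟨ +-cong refl (∑-cong (suc k) (λ i → sym (pascal-term k i (g (suc i))))) ⟩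
    g₀ + ∑ (suc k) (λ i → cC k i * g (suc i) + cC k (suc i) * g (suc i))
      ≈⟨ +-cong refl (∑-+ (suc k) (λ i → cC k i * g (suc i)) (λ i → cC k (suc i) * g (suc i))) ⟩
    g₀ + (X + ∑ (suc k) (λ i → cC k (suc i) * g (suc i)))
      ≈⟨ +-cong refl (+-cong refl (binomial-tail k (λ i → g (suc i)))) ⟩
    g₀ + (X + Z)
      ≈⟨ +-CS.x∙yz≈xz∙y g₀ X Z ⟩
    (g₀ + Z) + X ∎
    where
    g₀ = cC k 0 * g 0
    X  = ∑ (suc k) (λ i → cC k i * g (suc i))
    Z  = ∑ k (λ i → cC k (suc i) * g (suc i))

  hockey-stick : ∀ (g : Seq) p → ∑ (suc p) (λ k → ∑ (suc k) (λ i → cC k i * g i))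
                                 ≈ ∑ (suc p) (λ i → cC (suc p) (suc i) * g i)
  hockey-stick g zero    = +-cong (+-identityʳ _) refl
  hockey-stick g (suc p) = begin
    ∑ (suc (suc p)) H                                  ≈⟨ ∑-last (suc p) H ⟩
    ∑ (suc p) H + H (suc p)                            ≈⟨ +-comm _ _ ⟩
    H (suc p) + ∑ (suc p) H                            ≈⟨ +-cong refl (hockey-stick g p) ⟩
    H (suc p) + ∑ (suc p) (λ i → cC (suc p) (suc i) * g i)
      ≈⟨ +-cong refl (binomial-tail (suc p) g) ⟨
    H (suc p) + ∑ (suc (suc p)) (λ i → cC (suc p) (suc i) * g i)
      ≈⟨ ∑-+ (suc (suc p)) (λ i → cC (suc p) i * g i) (λ i → cC (suc p) (suc i) * g i) ⟨
    ∑ (suc (suc p)) (λ i → cC (suc p) i * g i + cC (suc p) (suc i) * g i)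
      ≈⟨ ∑-cong (suc (suc p)) (λ i → pascal-term (suc p) i (g i)) ⟩
    ∑ (suc (suc p)) (λ i → cC (suc (suc p)) (suc i) * g i) ∎
    where
    H : Seq
    H k = ∑ (suc k) (λ i → cC k i * g i)

  module BinomialTheorem
    (T : Seq → Seq)
    (T-cong : ∀ {f g} → f ≋ g → T f ≋ T g)
    (T-+ : ∀ f g → T (λ j → f j + g j) ≋ (λ n → T f n + T g n))
    (T-* : ∀ x f → T (λ j → x * f j) ≋ (λ n → x * T f n))
    where

    T-zero : T (λ _ → 0#) ≋ (λ _ → 0#)
    T-zero n = begin
      T (λ _ → 0#) n        ≈⟨ T-cong (λ _ → sym (zeroˡ 0#)) n ⟩
      T (λ _ → 0# * 0#) n   ≈⟨ T-* 0# (λ _ → 0#) n ⟩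
      0# * T (λ _ → 0#) n   ≈⟨ zeroˡ _ ⟩
      0#                    ∎

    T-∑ : ∀ L (H : ℕ → Seq) → T (λ m → ∑ L (λ i → H i m)) ≋ (λ n → ∑ L (λ i → T (H i) n))
    T-∑ zero    H n = T-zero n
    T-∑ (suc L) H n = trans (T-+ (H 0) _ n) (+-cong refl (T-∑ L (λ i → H (suc i)) n))

    binomial-theorem : (X : ℕ → Seq) → (∀ k → X (suc k) ≋ (λ n → X k n + T (X k) n)) →
                       ∀ k → X k ≋ (λ n → ∑ (suc k) (λ i → cC k i * fold (X 0) T i n))
    binomial-theorem X step zero    n = sym (trans (+-identityʳ _) (trans (*-cong (+-identityʳ 1#) refl) (*-identityˡ _)))
    binomial-theorem X step (suc k) n = begin
      X (suc k) n                                    ≈⟨ step k n ⟩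
      X k n + T (X k) n                              ≈⟨ +-cong (IH n) (T-cong IH n) ⟩
      ∑ (suc k) (λ i → cC k i * Y i n) + T (λ m → ∑ (suc k) (λ i → cC k i * Y i m)) n
        ≈⟨ +-cong refl (T-∑ (suc k) (λ i m → cC k i * Y i m) n) ⟩
      ∑ (suc k) (λ i → cC k i * Y i n) + ∑ (suc k) (λ i → T (λ m → cC k i * Y i m) n)
        ≈⟨ +-cong refl (∑-cong (suc k) (λ i → T-* (cC k i) (Y i) n)) ⟩
      ∑ (suc k) (λ i → cC k i * Y i n) + ∑ (suc k) (λ i → cC k i * Y (suc i) n)
        ≈⟨ pascal-sum k (λ i → Y i n) ⟨
      ∑ (suc (suc k)) (λ i → cC (suc k) i * Y i n)   ∎
      where
      Y : ℕ → Seq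
      Y = fold (X 0) T
      IH : X k ≋ (λ n → ∑ (suc k) (λ i → cC k i * Y i n))
      IH = binomial-theorem X step k

  module Expansion (a₀ : Carrier) (qs : List Carrier) (u : Carrier) (u*a₀≈1 : u * a₀ ≈ 1#) where

    E : ℕ → Seq
    E k n = (u ^ᴿ k) * coeff (powP (a₀ ∷ qs) k) n

    Q : ℕ → Seq
    Q i = coeff (powP qs i)

    G : ℕ → Seq
    G i n = (u ^ᴿ i) * shiftBy i (Q i) n

    T : Seq → Seq
    T g n = u * sh (conv (coeff qs) g) n

    T-cong : ∀ {f g} → f ≋ g → T f ≋ T g
    T-cong eq n = *-cong refl (sh-cong (conv-congʳ (coeff qs) eq) n)

    T-+ : ∀ f g → T (λ j → f j + g j) ≋ (λ n → T f n + T g n)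
    T-+ f g n = trans (*-cong refl (trans (sh-cong (conv-+ʳ (coeff qs) f g) n) (sh-+ _ _ n)))
                      (distribˡ u _ _)

    T-* : ∀ x f → T (λ j → x * f j) ≋ (λ n → x * T f n)
    T-* x f n = begin
      u * sh (conv (coeff qs) (λ j → x * f j)) n  ≈⟨ *-cong refl (sh-cong (conv-*ʳ (coeff qs) f x) n) ⟩
      u * sh (λ j → x * conv (coeff qs) f j) n    ≈⟨ *-cong refl (sh-* x _ n) ⟨
      u * (x * sh (conv (coeff qs) f) n)          ≈⟨ *-CS.x∙yz≈y∙xz u x _ ⟩
      x * (u * sh (conv (coeff qs) f) n)          ∎

    -- uᵏ⁺¹ p_aᵏ⁺¹ = uᵏ p_aᵏ + u t q · uᵏ p_aᵏ, since u a₀ = 1.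
    E-step : ∀ k → E (suc k) ≋ (λ n → E k n + T (E k) n)
    E-step k n = begin
      (u * uᵏ) * coeff (mulP (a₀ ∷ qs) (powP (a₀ ∷ qs) k)) n
        ≈⟨ *-cong refl (coeff-mulP (a₀ ∷ qs) (powP (a₀ ∷ qs) k) n) ⟩
      (u * uᵏ) * conv (coeff (a₀ ∷ qs)) Pₖ n
        ≈⟨ *-cong refl (conv-cons a₀ qs Pₖ n) ⟩
      (u * uᵏ) * (a₀ * Pₖ n + sh (conv (coeff qs) Pₖ) n)
        ≈⟨ distribˡ _ _ _ ⟩
      (u * uᵏ) * (a₀ * Pₖ n) + (u * uᵏ) * sh (conv (coeff qs) Pₖ) n
        ≈⟨ +-cong cancel-u (*-assoc u uᵏ _) ⟩
      E k n + u * (uᵏ * sh (conv (coeff qs) Pₖ) n)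
        ≈⟨ +-cong refl (*-cong refl (sh-* uᵏ _ n)) ⟩
      E k n + u * sh (λ j → uᵏ * conv (coeff qs) Pₖ j) n
        ≈⟨ +-cong refl (*-cong refl (sh-cong (conv-*ʳ (coeff qs) Pₖ uᵏ) n)) ⟨
      E k n + T (E k) n ∎
      where
      uᵏ = u ^ᴿ k
      Pₖ = coeff (powP (a₀ ∷ qs) k)
      cancel-u : (u * uᵏ) * (a₀ * Pₖ n) ≈ uᵏ * Pₖ n
      cancel-u = begin
        (u * uᵏ) * (a₀ * Pₖ n)  ≈⟨ *-CS.interchange u uᵏ a₀ (Pₖ n) ⟩
        (u * a₀) * (uᵏ * Pₖ n)  ≈⟨ *-cong u*a₀≈1 refl ⟩
        1# * (uᵏ * Pₖ n)        ≈⟨ *-identityˡ _ ⟩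
        uᵏ * Pₖ n               ∎

    T-G : ∀ i → T (G i) ≋ G (suc i)
    T-G i n = begin
      u * sh (conv (coeff qs) (G i)) n
        ≈⟨ *-cong refl (sh-cong (λ m → trans (conv-*ʳ (coeff qs) _ (u ^ᴿ i) m)
                                   (*-cong refl (conv-shiftBy (coeff qs) (Q i) i m))) n) ⟩
      u * sh (λ m → (u ^ᴿ i) * shiftBy i (conv (coeff qs) (Q i)) m) n
        ≈⟨ *-cong refl (sh-cong (λ m → *-cong refl (shiftBy-cong i (λ j → sym (coeff-mulP qs (powP qs i) j)) m)) n) ⟩
      u * sh (λ m → (u ^ᴿ i) * shiftBy i (Q (suc i)) m) n
        ≈⟨ *-cong refl (sh-* (u ^ᴿ i) _ n) ⟨
      u * ((u ^ᴿ i) * shiftBy (suc i) (Q (suc i)) n)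
        ≈⟨ *-assoc u (u ^ᴿ i) _ ⟨
      G (suc i) n ∎

    T-power : ∀ i → fold (E 0) T i ≋ G i
    T-power zero    n = refl
    T-power (suc i) n = trans (T-cong (T-power i) n) (T-G i n)

    E-expansion : ∀ k → E k ≋ (λ n → ∑ (suc k) (λ i → cC k i * G i n))
    E-expansion k n = trans (binomial-theorem E E-step k n)
                            (∑-cong (suc k) (λ i → *-cong (refl {cC k i}) (T-power i n)))
      where open BinomialTheorem T T-cong T-+ T-*

  partial-sum-identity : ∀ k a₀ u (w : Vec Carrier (suc k)) → u * a₀ ≈ 1# → ∀ p n →
    sumFromTo 0 p (λ j → (u ^ᴿ j) * polyCoeff (a₀ ∷ toList w) j n)
      ≈ sumFromTo (ceilDiv n (suc k)) n (λ i →
          (u ^ᴿ i) * (coeff (powP (toList w) i) (n ∸ i) * ((suc p C suc i) ×ᴿ 1#)))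
  partial-sum-identity k a₀ u w u*a₀≈1 p n = begin
    sumCount 0 (suc p) (λ j → E j n)                    ≈⟨ sumCount-∑ 0 (suc p) _ ⟩
    ∑ (suc p) (λ j → E j n)                             ≈⟨ ∑-cong (suc p) (λ j → E-expansion j n) ⟩
    ∑ (suc p) (λ j → ∑ (suc j) (λ i → cC j i * G i n)) ≈⟨ hockey-stick (λ i → G i n) p ⟩
    ∑ (suc p) f                                         ≈⟨ ∑-truncation (suc p) (suc n) f beyond-p beyond-n ⟩
    ∑ (suc n) f                                         ≡⟨ P.cong (λ L → ∑ L f) (ℕP.m+[n∸m]≡n lo≤1+n) ⟨
    ∑ (lo ℕ.+ (suc n ∸ lo)) f                           ≈⟨ ∑-window lo (suc n ∸ lo) below-lo in-window ⟩
    sumCount lo (suc n ∸ lo) target                     ∎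
    where
    open Expansion a₀ (toList w) u u*a₀≈1
    lo : ℕ
    lo = ceilDiv n (suc k)
    lo≤1+n : lo ≤ suc n
    lo≤1+n = ℕP.m≤n⇒m≤1+n (ceilDiv-≤ n k)
    f target : Seq
    f i = cC (suc p) (suc i) * G i n
    target i = (u ^ᴿ i) * (Q i (n ∸ i) * cC (suc p) (suc i))
    vanishing-shift : ∀ i → shiftBy i (Q i) n ≈ 0# → f i ≈ 0#
    vanishing-shift i eq = trans (*-cong refl (trans (*-cong refl eq) (zeroʳ _))) (zeroʳ _)
    beyond-p : ∀ i → suc p ≤ i → f i ≈ 0#
    beyond-p i p<i = trans (*-cong (cC-vanishes (s≤s p<i)) refl) (zeroˡ _)
    beyond-n : ∀ i → suc n ≤ i → f i ≈ 0#
    beyond-n i n<i = vanishing-shift i (shiftBy-below i (Q i) n n<i)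
    below-lo : ∀ i → i < lo → f i ≈ 0#
    below-lo i i<lo = vanishing-shift i (trans (shiftBy-above i (Q i) n (ℕP.<⇒≤ (ℕP.<-≤-trans i<lo (ceilDiv-≤ n k))))
      (powP-vanishes k (toList w) (vector-vanishes w) i (n ∸ i) (<ceilDiv⇒*<∸ n k i i<lo)))
    in-window : ∀ j → j < suc n ∸ lo → f (lo ℕ.+ j) ≈ target (lo ℕ.+ j)
    in-window j j<len = trans (*-cong refl (*-cong refl (shiftBy-above i (Q i) n i≤n)))
                              (*-CS.x∙yz≈y∙zx _ _ _)
      where
      i = lo ℕ.+ j
      i≤n : i ≤ n
      i≤n = ℕP.≤-pred (P.subst (i <_) (ℕP.m+[n∸m]≡n lo≤1+n) (ℕP.+-monoʳ-< lo j<len))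

mainTheorem8 : ∀ {c ℓ} (F : Field c ℓ) → let open Field F in let open Poly commutativeRing in
    (m : ℕ) → 1 ≤ m → (a : Vec Carrier (suc m)) → (a0≠0 : ¬ (head a ≈ 0#)) →
    (p n : ℕ) →
    sumFromTo 0 p (λ k → (inv (head a) a0≠0 ^ᴿ k) * polyCoeff (toList a) k n)
      ≈ sumFromTo (ceilDiv n m) n (λ i →
          (inv (head a) a0≠0 ^ᴿ i)
            * (coeff (powP (toList (tail a)) i) (n ∸ i) * ((suc p C suc i) ×ᴿ 1#)))
mainTheorem8 F (suc k) _ (a₀ ∷ᵥ w) a₀≉0 =
  partial-sum-identity k a₀ (inv a₀ a₀≉0) w (trans (*-comm _ _) (inv-right a₀ a₀≉0))
  where
  open Field F
  open Development commutativeRing
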